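{- For $N\in\mathbb{N}$, \begin{equation*} (aq)_N\sum_{n=1}^{N}\left[\begin{matrix} N \\ n\end{matrix}\right]\frac{na^nq^{n^2}}{(aq)_n}=\sum_{n=1}^{N}\left[\begin{matrix} N \\ n\end{matrix}\right]\frac{(q)_n(-1)^{n-1}a^nq^\frac{n(n+1)}{2}}{1-q^n}. \end{equation*}
   Context: $|q|<1$; $(a)_n=(a;q)_n=(1-a)(1-aq)\cdots(1-aq^{n-1})$ with $(a)_0=1$. The $q$-binomial coefficient is $\left[\begin{matrix} N \\ n\end{matrix}\right]=\frac{(q)_N}{(q)_n(q)_{N-n}}$ for $0\le n\le N$ and $0$ otherwise. $a$ is complex with all denominators nonzero. -}

module Defs where

open import Level using (Level)
open import Algebra.Bundles using (CommutativeRing)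
open import Data.Nat as ℕ using (ℕ; zero; suc)
open import Data.Bool using (true; false)

module QDefs {c ℓ : Level} (R : CommutativeRing c ℓ) where
  open CommutativeRing R

  pow : Carrier → ℕ → Carrier
  pow x zero    = 1#
  pow x (suc k) = x * pow x k

  fromℕ : ℕ → Carrier
  fromℕ zero    = 0#
  fromℕ (suc k) = 1# + fromℕ k

  poch : Carrier → Carrier → ℕ → Carrier
  poch x q zero    = 1#
  poch x q (suc k) = poch x q k * (1# - x * pow q k)

  sum1 : ℕ → (ℕ → Carrier) → Carrier
  sum1 zero    f = 0#
  sum1 (suc N) f = sum1 N f + f (suc N)

  -- q-binomial coefficient [N n] = (q)_N / ((q)_n (q)_{N-n}) for n ≤ N, 0 otherwise,
  -- where iq k is a given inverse of (q;q)_k.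
  qbinom : (q : Carrier) → (iq : ℕ → Carrier) → ℕ → ℕ → Carrier
  qbinom q iq N n with n ℕ.≤ᵇ N
  ... | true  = poch q q N * iq n * iq (N ℕ.∸ n)
  ... | false = 0#

{-# OPTIONS --safe #-}
module Submission where

open import Defs
open import Level using (Level; 0ℓ)
open import Algebra.Bundles using (CommutativeRing; RawRing)
open import Data.Nat using (ℕ; suc; _≤_; _∸_; _/_)
open import Data.Nat using () renaming (_*_ to _*ℕ_)
import Data.Nat as ℕ
open import Data.Nat using (zero; _<_; z≤n; s≤s)
import Data.Nat.Properties as ℕₚ
open import Data.Nat.DivMod using (m*n/n≡m)
open import Data.Nat.Tactic.RingSolver using (solve-∀)
open import Data.Product using (_×_; _,_)
open import Data.Sum using (inj₁; inj₂)
open import Data.Maybe using (Maybe; just; nothing)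
open import Data.Bool using (true)
import Relation.Binary.PropositionalEquality as ≡
open import Relation.Nullary using (yes; no)
import Algebra.Solver.Ring.AlmostCommutativeRing as ACR

-- Clearing (aq)_N and the inverses turns the two sides into
--   L_N(a) = Σ_{n=0}^{N} [N n] n a^n q^{n²} (aq^{n+1};q)_{N-n}        (Στ fromℕ N a)
--   R_N(a) = Σ_{n=1}^{N} [N n] (q)_{n-1} (-1)^{n-1} a^n q^{n(n+1)/2}   (Σρ N a),
-- with [N n] the polynomial Gaussian binomial. Splitting [N+1 n] by the q-Pascal rule
-- shows that both satisfy
--   F_{N+1}(a) = (1 - aq^{N+1}) F_N(a) + aq^{N+1} (F_N(aq) + 1),   F_0 = 0,
-- so they agree by induction on N. For L this uses that the same sum with weight 1 in
-- place of n is identically 1; for R it uses that the sum with (q)_n (-1)^n in place of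
-- (q)_{n-1} (-1)^{n-1} is 1 - R_N(a) + R_N(aq). Everything happens in an arbitrary
-- commutative ring; the inverses are only used to identify the individual terms.

-- The library's ring solvers over an abstract commutative ring take natural or
-- ring-element coefficients, with which x - x does not normalise to 0.
module IntegerCoefficientRingSolver {c ℓ : Level} (R : CommutativeRing c ℓ) where
  open CommutativeRing R
  open import Algebra.Properties.Ring ring using (x[y-z]≈xy-xz; [y-z]x≈yx-zx; ⁻¹-anti-homo‿-; -0#≈0#)
  open import Algebra.Properties.AbelianGroup +-abelianGroup using (⁻¹-∙-comm)
  open import Algebra.Properties.CommutativeSemigroup +-commutativeSemigroup using (interchange)
  open import Algebra.Properties.Semiring.Mult.TCOptimised semiring
    using (1+×; ×-homo-+; ×1-homo-*) renaming (_×_ to _·_)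
  open import Relation.Binary.Reasoning.Setoid setoid

  private
    difference-+ : ∀ x y u v → (x + u) - (y + v) ≈ (x - y) + (u - v)
    difference-+ x y u v = begin
      (x + u) - (y + v)     ≈⟨ +-congˡ (sym (⁻¹-∙-comm y v)) ⟩
      (x + u) + (- y + - v) ≈⟨ interchange x u (- y) (- v) ⟩
      (x - y) + (u - v)     ∎

    difference-* : ∀ x y u v → (x * u + y * v) - (x * v + y * u) ≈ (x - y) * (u - v)
    difference-* x y u v = begin
      (x * u + y * v) - (x * v + y * u)     ≈⟨ difference-+ _ _ _ _ ⟩
      (x * u - x * v) + (y * v - y * u)     ≈⟨ +-congˡ (sym (⁻¹-anti-homo‿- _ _)) ⟩
      (x * u - x * v) - (y * u - y * v)     ≈⟨ +-cong (x[y-z]≈xy-xz x u v) (-‿cong (x[y-z]≈xy-xz y u v)) ⟨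
      x * (u - v) - y * (u - v)             ≈⟨ sym ([y-z]x≈yx-zx _ x y) ⟩
      (x - y) * (u - v)                     ∎

    cancel-1+ : ∀ x y → (1# + x) - (1# + y) ≈ x - y
    cancel-1+ x y = begin
      (1# + x) - (1# + y) ≈⟨ difference-+ 1# 1# x y ⟩
      (1# - 1#) + (x - y) ≈⟨ +-congʳ (-‿inverseʳ 1#) ⟩
      0# + (x - y)        ≈⟨ +-identityˡ _ ⟩
      x - y               ∎

    -- The pair (m , n) stands for the integer m - n. Coefficients are kept
    -- normalised (m or n is 0) so that equal integers are syntactically equal,
    -- and ⟦_⟧ is chosen so that ⟦ 1 , 0 ⟧ and ⟦ 0 , 0 ⟧ are 1# and 0# on the nose.
    ⟦_⟧ : ℕ × ℕ → Carrier
    ⟦ m     , zero  ⟧ = m · 1#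
    ⟦ zero  , suc n ⟧ = - (suc n · 1#)
    ⟦ suc m , suc n ⟧ = ⟦ m , n ⟧

    ⟦⟧≈difference : ∀ m n → ⟦ m , n ⟧ ≈ m · 1# - n · 1#
    ⟦⟧≈difference m       zero    = sym (trans (+-congˡ -0#≈0#) (+-identityʳ _))
    ⟦⟧≈difference zero    (suc n) = sym (+-identityˡ _)
    ⟦⟧≈difference (suc m) (suc n) = begin
      ⟦ m , n ⟧                         ≈⟨ ⟦⟧≈difference m n ⟩
      m · 1# - n · 1#                   ≈⟨ cancel-1+ (m · 1#) (n · 1#) ⟨
      (1# + m · 1#) - (1# + n · 1#)     ≈⟨ +-cong (1+× m 1#) (-‿cong (1+× n 1#)) ⟨
      suc m · 1# - suc n · 1#           ∎

    normalise : ℕ → ℕ → ℕ × ℕ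
    normalise (suc m) (suc n) = normalise m n
    normalise m       n       = m , n

    normalise-sound : ∀ m n → ⟦ normalise m n ⟧ ≈ ⟦ m , n ⟧
    normalise-sound zero    n       = refl
    normalise-sound (suc m) zero    = refl
    normalise-sound (suc m) (suc n) = normalise-sound m n

    ℤ-rawRing : RawRing 0ℓ 0ℓ
    ℤ-rawRing = record
      { Carrier = ℕ × ℕ
      ; _≈_     = ≡._≡_
      ; _+_     = λ { (m , n) (m′ , n′) → normalise (m ℕ.+ m′) (n ℕ.+ n′) }
      ; _*_     = λ { (m , n) (m′ , n′) →
                      normalise (m ℕ.* m′ ℕ.+ n ℕ.* n′) (m ℕ.* n′ ℕ.+ n ℕ.* m′) }
      ; -_      = λ { (m , n) → n , m }
      ; 0#      = 0 , 0
      ; 1#      = 1 , 0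
      }

    ℤ-homomorphism : ℤ-rawRing ACR.-Raw-AlmostCommutative⟶ ACR.fromCommutativeRing R
    ℤ-homomorphism = record
      { ⟦_⟧    = ⟦_⟧
      ; +-homo = λ { (m , n) (m′ , n′) → begin
          ⟦ normalise (m ℕ.+ m′) (n ℕ.+ n′) ⟧
            ≈⟨ normalise-sound (m ℕ.+ m′) (n ℕ.+ n′) ⟩
          ⟦ m ℕ.+ m′ , n ℕ.+ n′ ⟧
            ≈⟨ ⟦⟧≈difference (m ℕ.+ m′) (n ℕ.+ n′) ⟩
          (m ℕ.+ m′) · 1# - (n ℕ.+ n′) · 1#
            ≈⟨ +-cong (×-homo-+ 1# m m′) (-‿cong (×-homo-+ 1# n n′)) ⟩
          (m · 1# + m′ · 1#) - (n · 1# + n′ · 1#)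
            ≈⟨ difference-+ _ _ _ _ ⟩
          (m · 1# - n · 1#) + (m′ · 1# - n′ · 1#)
            ≈⟨ +-cong (⟦⟧≈difference m n) (⟦⟧≈difference m′ n′) ⟨
          ⟦ m , n ⟧ + ⟦ m′ , n′ ⟧ ∎ }
      ; *-homo = λ { (m , n) (m′ , n′) → begin
          ⟦ normalise (m ℕ.* m′ ℕ.+ n ℕ.* n′) (m ℕ.* n′ ℕ.+ n ℕ.* m′) ⟧
            ≈⟨ normalise-sound (m ℕ.* m′ ℕ.+ n ℕ.* n′) (m ℕ.* n′ ℕ.+ n ℕ.* m′) ⟩
          ⟦ m ℕ.* m′ ℕ.+ n ℕ.* n′ , m ℕ.* n′ ℕ.+ n ℕ.* m′ ⟧
            ≈⟨ ⟦⟧≈difference (m ℕ.* m′ ℕ.+ n ℕ.* n′) (m ℕ.* n′ ℕ.+ n ℕ.* m′) ⟩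
          (m ℕ.* m′ ℕ.+ n ℕ.* n′) · 1# - (m ℕ.* n′ ℕ.+ n ℕ.* m′) · 1#
            ≈⟨ +-cong (trans (×-homo-+ 1# (m ℕ.* m′) _) (+-cong (×1-homo-* m m′) (×1-homo-* n n′)))
                 (-‿cong (trans (×-homo-+ 1# (m ℕ.* n′) _) (+-cong (×1-homo-* m n′) (×1-homo-* n m′)))) ⟩
          (m · 1# * m′ · 1# + n · 1# * n′ · 1#) - (m · 1# * n′ · 1# + n · 1# * m′ · 1#)
            ≈⟨ difference-* _ _ _ _ ⟩
          (m · 1# - n · 1#) * (m′ · 1# - n′ · 1#)
            ≈⟨ *-cong (⟦⟧≈difference m n) (⟦⟧≈difference m′ n′) ⟨
          ⟦ m , n ⟧ * ⟦ m′ , n′ ⟧ ∎ }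
      ; -‿homo = λ { (m , n) → begin
          ⟦ n , m ⟧             ≈⟨ ⟦⟧≈difference n m ⟩
          n · 1# - m · 1#       ≈⟨ ⁻¹-anti-homo‿- (m · 1#) (n · 1#) ⟨
          - (m · 1# - n · 1#)   ≈⟨ -‿cong (⟦⟧≈difference m n) ⟨
          - ⟦ m , n ⟧           ∎ }
      ; 0-homo = refl
      ; 1-homo = refl
      }

    ≟-coefficient : ∀ x y → Maybe (ACR.Induced-equivalence ℤ-homomorphism x y)
    ≟-coefficient (m , n) (m′ , n′) with m ℕ.≟ m′ | n ℕ.≟ n′
    ... | yes ≡.refl | yes ≡.refl = just refl
    ... | _          | _          = nothing

  open import Algebra.Solver.Ring ℤ-rawRing (ACR.fromCommutativeRing R) ℤ-homomorphism ≟-coefficient public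

  :0 :1 : ∀ {n} → Polynomial n
  :0 = con (0 , 0)
  :1 = con (1 , 0)

triangle : ℕ → ℕ
triangle zero    = 0
triangle (suc n) = suc n ℕ.+ triangle n

n*[1+n]/2≡triangle : ∀ n → (n *ℕ suc n) / 2 ≡.≡ triangle n
n*[1+n]/2≡triangle n = ≡.trans (≡.cong (_/ 2) (double n)) (m*n/n≡m (triangle n) 2)
  where
  double : ∀ n → n *ℕ suc n ≡.≡ triangle n *ℕ 2
  double zero    = ≡.refl
  double (suc n) = begin
    suc n *ℕ suc (suc n)               ≡⟨ expand n ⟩
    suc n *ℕ 2 ℕ.+ n *ℕ suc n          ≡⟨ ≡.cong (suc n *ℕ 2 ℕ.+_) (double n) ⟩
    suc n *ℕ 2 ℕ.+ triangle n *ℕ 2     ≡⟨ ℕₚ.*-distribʳ-+ 2 (suc n) (triangle n) ⟨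
    (suc n ℕ.+ triangle n) *ℕ 2        ∎
    where
    open ≡.≡-Reasoning
    expand : ∀ n → suc n *ℕ suc (suc n) ≡.≡ suc n *ℕ 2 ℕ.+ n *ℕ suc n
    expand = solve-∀

module Pochhammer {c ℓ : Level} (R : CommutativeRing c ℓ) where
  open CommutativeRing R
  open QDefs R
  open IntegerCoefficientRingSolver R using (solve; _:=_; _:*_; _:-_; :1)
  open import Relation.Binary.Reasoning.Setoid setoid
  open import Algebra.Properties.Semiring.Exp semiring using (_^_; ^-homo-*)
  open import Algebra.Properties.CommutativeSemiring.Exp commutativeSemiring using (^-distrib-*)

  pow≡^ : ∀ x n → pow x n ≡.≡ x ^ n
  pow≡^ x zero    = ≡.refl
  pow≡^ x (suc n) = ≡.cong (x *_) (pow≡^ x n)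

  pow-+ : ∀ x m n → pow x (m ℕ.+ n) ≈ pow x m * pow x n
  pow-+ x m n rewrite pow≡^ x (m ℕ.+ n) | pow≡^ x m | pow≡^ x n = ^-homo-* x m n

  pow-* : ∀ x y n → pow (x * y) n ≈ pow x n * pow y n
  pow-* x y n rewrite pow≡^ (x * y) n | pow≡^ x n | pow≡^ y n = ^-distrib-* x y n

  pow-+-∸ : ∀ x {m n} → m ≤ n → pow x m * pow x (n ∸ m) ≈ pow x n
  pow-+-∸ x {m} {n} m≤n = begin
    pow x m * pow x (n ∸ m)   ≈⟨ pow-+ x m (n ∸ m) ⟨
    pow x (m ℕ.+ (n ∸ m))     ≡⟨ ≡.cong (pow x) (ℕₚ.m+[n∸m]≡n m≤n) ⟩
    pow x n                   ∎

  poch-cong : ∀ {x y} q k → x ≈ y → poch x q k ≈ poch y q k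
  poch-cong q zero    x≈y = refl
  poch-cong q (suc k) x≈y = *-cong (poch-cong q k x≈y) (+-congˡ (-‿cong (*-congʳ x≈y)))

  poch-+ : ∀ x q m k → poch x q (m ℕ.+ k) ≈ poch x q m * poch (x * pow q m) q k
  poch-+ x q m zero    = trans (reflexive (≡.cong (poch x q) (ℕₚ.+-identityʳ m))) (sym (*-identityʳ _))
  poch-+ x q m (suc k) = begin
    poch x q (m ℕ.+ suc k)
      ≡⟨ ≡.cong (poch x q) (ℕₚ.+-suc m k) ⟩
    poch x q (m ℕ.+ k) * (1# - x * pow q (m ℕ.+ k))
      ≈⟨ *-cong (poch-+ x q m k) (+-congˡ (-‿cong (*-congˡ (pow-+ q m k)))) ⟩
    poch x q m * poch (x * pow q m) q k * (1# - x * (pow q m * pow q k))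
      ≈⟨ solve 5 (λ p p′ x y z → p :* p′ :* (:1 :- x :* (y :* z)) := p :* (p′ :* (:1 :- x :* y :* z)))
           refl _ _ x (pow q m) (pow q k) ⟩
    poch x q m * (poch (x * pow q m) q k * (1# - x * pow q m * pow q k)) ∎

module Sums {c ℓ : Level} (R : CommutativeRing c ℓ) where
  open CommutativeRing R
  open QDefs R
  open IntegerCoefficientRingSolver R using (solve; _:=_; _:+_; _:-_)
  open import Relation.Binary.Reasoning.Setoid setoid

  sum0 : ℕ → (ℕ → Carrier) → Carrier
  sum0 N f = f 0 + sum1 N f

  sum1-cong : ∀ N {f g : ℕ → Carrier} → (∀ m → m < N → f (suc m) ≈ g (suc m)) →
              sum1 N f ≈ sum1 N g
  sum1-cong zero    f≈g = refl
  sum1-cong (suc N) f≈g =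
    +-cong (sum1-cong N (λ m m<N → f≈g m (ℕₚ.m<n⇒m<1+n m<N))) (f≈g N (ℕₚ.n<1+n N))

  sum1-distrib-+ : ∀ N (f g : ℕ → Carrier) → sum1 N (λ n → f n + g n) ≈ sum1 N f + sum1 N g
  sum1-distrib-+ zero    f g = sym (+-identityˡ 0#)
  sum1-distrib-+ (suc N) f g = trans (+-congʳ (sum1-distrib-+ N f g))
    (solve 4 (λ F G f g → (F :+ G) :+ (f :+ g) := (F :+ f) :+ (G :+ g)) refl _ _ _ _)

  sum1-distrib-− : ∀ N (f g : ℕ → Carrier) → sum1 N (λ n → f n - g n) ≈ sum1 N f - sum1 N g
  sum1-distrib-− zero    f g = sym (-‿inverseʳ 0#)
  sum1-distrib-− (suc N) f g = trans (+-congʳ (sum1-distrib-− N f g))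
    (solve 4 (λ F G f g → (F :- G) :+ (f :- g) := (F :+ f) :- (G :+ g)) refl _ _ _ _)

  *-distribˡ-sum1 : ∀ N x (f : ℕ → Carrier) → x * sum1 N f ≈ sum1 N (λ n → x * f n)
  *-distribˡ-sum1 zero    x f = zeroʳ x
  *-distribˡ-sum1 (suc N) x f = trans (distribˡ x _ _) (+-congʳ (*-distribˡ-sum1 N x f))

  sum1≈sum0-shift : ∀ N (f : ℕ → Carrier) → sum1 (suc N) f ≈ sum0 N (λ m → f (suc m))
  sum1≈sum0-shift zero    f = trans (+-identityˡ _) (sym (+-identityʳ _))
  sum1≈sum0-shift (suc N) f = trans (+-congʳ (sum1≈sum0-shift N f)) (+-assoc _ _ _)

  sum0-cong : ∀ N {f g : ℕ → Carrier} → (∀ n → n ≤ N → f n ≈ g n) → sum0 N f ≈ sum0 N g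
  sum0-cong N f≈g = +-cong (f≈g 0 z≤n) (sum1-cong N (λ m m<N → f≈g (suc m) m<N))

  sum0-distrib-+ : ∀ N (f g : ℕ → Carrier) → sum0 N (λ n → f n + g n) ≈ sum0 N f + sum0 N g
  sum0-distrib-+ N f g = trans (+-congˡ (sum1-distrib-+ N f g))
    (solve 4 (λ f g F G → (f :+ g) :+ (F :+ G) := (f :+ F) :+ (g :+ G)) refl _ _ _ _)

  *-distribˡ-sum0 : ∀ N x (f : ℕ → Carrier) → x * sum0 N f ≈ sum0 N (λ n → x * f n)
  *-distribˡ-sum0 N x f = trans (distribˡ x _ _) (+-congˡ (*-distribˡ-sum1 N x f))

  sum0≈sum1 : ∀ N {f : ℕ → Carrier} → f 0 ≈ 0# → sum0 N f ≈ sum1 N f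
  sum0≈sum1 N f0≈0 = trans (+-congʳ f0≈0) (+-identityˡ _)

module GaussianBinomials {c ℓ : Level} (R : CommutativeRing c ℓ) (q : CommutativeRing.Carrier R) where
  open CommutativeRing R
  open QDefs R
  open Pochhammer R
  open IntegerCoefficientRingSolver R using (solve; _:=_; _:+_; _:*_; _:-_; :0; :1)
  open import Relation.Binary.Reasoning.Setoid setoid

  q! : ℕ → Carrier
  q! = poch q q

  gaussian : ℕ → ℕ → Carrier
  gaussian N       zero    = 1#
  gaussian zero    (suc n) = 0#
  gaussian (suc N) (suc n) = gaussian N (suc n) + pow q (N ∸ n) * gaussian N n

  gaussian-above : ∀ {N n} → N < n → gaussian N n ≈ 0#
  gaussian-above {zero}  {suc n} _         = refl
  gaussian-above {suc N} {suc n} (s≤s N<n) =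
    trans (+-cong (gaussian-above (ℕₚ.m<n⇒m<1+n N<n)) (*-congˡ (gaussian-above N<n)))
          (trans (+-identityˡ _) (zeroʳ _))

  gaussian-diag : ∀ N → gaussian N N ≈ 1#
  gaussian-diag zero    = refl
  gaussian-diag (suc N) = begin
    gaussian N (suc N) + pow q (N ∸ N) * gaussian N N
      ≈⟨ +-cong (gaussian-above (ℕₚ.n<1+n N)) (*-congˡ (gaussian-diag N)) ⟩
    0# + pow q (N ∸ N) * 1#   ≡⟨ ≡.cong (λ k → 0# + pow q k * 1#) (ℕₚ.n∸n≡0 N) ⟩
    0# + 1# * 1#              ≈⟨ trans (+-identityˡ _) (*-identityˡ 1#) ⟩
    1#                        ∎

  factorial-pascal-step : ∀ n k t {P G₁ G₂} → q! t ≈ q! k * (1# - pow q t) →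
              q! (suc n) * q! k * G₁ ≈ P → q! n * q! t * G₂ ≈ P →
              q! (suc n) * q! t * (G₁ + pow q t * G₂) ≈ P * (1# - pow q (suc n) * pow q t)
  factorial-pascal-step n k t {P} {G₁} {G₂} q!t q!G₁ q!G₂ = begin
    q! (suc n) * q! t * (G₁ + pow q t * G₂)
      ≈⟨ *-cong (*-congˡ q!t) refl ⟩
    q! n * (1# - pow q (suc n)) * (q! k * (1# - pow q t)) * (G₁ + pow q t * G₂)
      ≈⟨ solve 6 (λ a b c d f g → a :* (:1 :- b) :* (c :* (:1 :- d)) :* (f :+ d :* g)
                                   := (:1 :- d) :* (a :* (:1 :- b) :* c :* f)
                                      :+ (:1 :- b) :* d :* (a :* (c :* (:1 :- d)) :* g))
              refl (q! n) (pow q (suc n)) (q! k) (pow q t) G₁ G₂ ⟩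
    (1# - pow q t) * (q! (suc n) * q! k * G₁)
      + (1# - pow q (suc n)) * pow q t * (q! n * (q! k * (1# - pow q t)) * G₂)
      ≈⟨ +-cong (*-congˡ q!G₁) (*-congˡ (trans (*-congʳ (*-congˡ (sym q!t))) q!G₂)) ⟩
    (1# - pow q t) * P + (1# - pow q (suc n)) * pow q t * P
      ≈⟨ solve 3 (λ x y p → (:1 :- x) :* p :+ (:1 :- y) :* x :* p := p :* (:1 :- y :* x))
           refl (pow q t) (pow q (suc n)) P ⟩
    P * (1# - pow q (suc n) * pow q t) ∎

  gaussian-factorial : ∀ N n → n ≤ N → q! n * q! (N ∸ n) * gaussian N n ≈ q! N
  gaussian-factorial N zero _ = trans (*-identityʳ _) (*-identityˡ _)
  gaussian-factorial (suc N) (suc n) (s≤s n≤N) with ℕₚ.m≤n⇒m<n∨m≡n n≤N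
  ... | inj₂ ≡.refl = begin
    q! (suc n) * q! (n ∸ n) * (gaussian n (suc n) + pow q (n ∸ n) * gaussian n n)
      ≡⟨ ≡.cong (λ k → q! (suc n) * q! k * (gaussian n (suc n) + pow q k * gaussian n n))
                (ℕₚ.n∸n≡0 n) ⟩
    q! (suc n) * 1# * (gaussian n (suc n) + 1# * gaussian n n)
      ≈⟨ *-congˡ (+-cong (gaussian-above (ℕₚ.n<1+n n)) (*-congˡ (gaussian-diag n))) ⟩
    q! (suc n) * 1# * (0# + 1# * 1#)
      ≈⟨ solve 1 (λ x → x :* :1 :* (:0 :+ :1 :* :1) := x) refl (q! (suc n)) ⟩
    q! (suc n) ∎
  ... | inj₁ n<N = begin
    q! (suc n) * q! (N ∸ n) * (gaussian N (suc n) + pow q (N ∸ n) * gaussian N n)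
      ≈⟨ factorial-pascal-step n (N ∸ suc n) (N ∸ n) q![N∸n]
           (gaussian-factorial N (suc n) n<N) (gaussian-factorial N n n≤N) ⟩
    q! N * (1# - pow q (suc n) * pow q (N ∸ n))
      ≈⟨ *-congˡ (+-congˡ (-‿cong (pow-+-∸ q (s≤s n≤N)))) ⟩
    q! N * (1# - q * pow q N) ∎
    where
    q![N∸n] : q! (N ∸ n) ≈ q! (N ∸ suc n) * (1# - pow q (N ∸ n))
    q![N∸n] rewrite ℕₚ.+-∸-assoc 1 n<N = refl

  qbinom≈gaussian : ∀ (iq : ℕ → Carrier) {N n} → (∀ k → k ≤ N → q! k * iq k ≈ 1#) → n ≤ N →
                 qbinom q iq N n ≈ gaussian N n
  qbinom≈gaussian iq {N} {n} iq-inverse n≤N with n ℕ.≤ᵇ N | ℕₚ.≤⇒≤ᵇ n≤N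
  ... | true | _ = begin
    q! N * iq n * iq (N ∸ n)
      ≈⟨ *-congʳ (*-congʳ (gaussian-factorial N n n≤N)) ⟨
    q! n * q! (N ∸ n) * gaussian N n * iq n * iq (N ∸ n)
      ≈⟨ solve 5 (λ a b g x y → a :* b :* g :* x :* y := g :* (a :* x) :* (b :* y)) refl _ _ _ _ _ ⟩
    gaussian N n * (q! n * iq n) * (q! (N ∸ n) * iq (N ∸ n))
      ≈⟨ *-cong (*-congˡ (iq-inverse n n≤N)) (iq-inverse (N ∸ n) (ℕₚ.m∸n≤m N n)) ⟩
    gaussian N n * 1# * 1#
      ≈⟨ trans (*-identityʳ _) (*-identityʳ _) ⟩
    gaussian N n ∎

module BothSides {c ℓ : Level} (R : CommutativeRing c ℓ) (q : CommutativeRing.Carrier R) where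
  open CommutativeRing R
  open QDefs R
  open Pochhammer R
  open Sums R
  open GaussianBinomials R q
  open IntegerCoefficientRingSolver R using (solve; _:=_; _:+_; _:*_; _:-_; :-_; :0; :1)
  open import Algebra.Properties.Ring ring using (x[y-z]≈xy-xz)
  open import Algebra.Properties.CommutativeSemigroup *-commutativeSemigroup
    using (x∙yz≈y∙xz; x∙yz≈z∙xy; x∙yz≈yx∙z)
  open import Relation.Binary.Reasoning.Setoid setoid

  pascal-sum0 : ∀ N (t : ℕ → Carrier) →
    sum0 (suc N) (λ n → gaussian (suc N) n * t n)
      ≈ sum0 N (λ n → gaussian N n * t n) + sum0 N (λ m → pow q (N ∸ m) * gaussian N m * t (suc m))
  pascal-sum0 N t = begin
    1# * t 0 + sum1 (suc N) (λ n → gaussian (suc N) n * t n)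
      ≈⟨ +-congˡ (sum1-cong (suc N) (λ m _ → distribʳ (t (suc m)) _ _)) ⟩
    1# * t 0 + sum1 (suc N) (λ n → gaussian N n * t n + shifted (ℕ.pred n))
      ≈⟨ +-congˡ (sum1-distrib-+ (suc N) _ _) ⟩
    1# * t 0 + ((sum1 N (λ n → gaussian N n * t n) + gaussian N (suc N) * t (suc N))
                + sum1 (suc N) (λ n → shifted (ℕ.pred n)))
      ≈⟨ +-congˡ (+-cong (+-congˡ (trans (*-congʳ (gaussian-above (ℕₚ.n<1+n N))) (zeroˡ _)))
                         (sum1≈sum0-shift N _)) ⟩
    1# * t 0 + ((sum1 N (λ n → gaussian N n * t n) + 0#) + sum0 N shifted)
      ≈⟨ solve 3 (λ x s s′ → x :+ ((s :+ :0) :+ s′) := (x :+ s) :+ s′) refl _ _ _ ⟩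
    sum0 N (λ n → gaussian N n * t n) + sum0 N shifted ∎
    where
    shifted : ℕ → Carrier
    shifted m = pow q (N ∸ m) * gaussian N m * t (suc m)

  pow-shift : ∀ {m N} e → m ≤ N → pow q (N ∸ m) * pow q (suc m ℕ.+ e) ≈ pow q (suc N) * pow q e
  pow-shift {m} {N} e m≤N = begin
    pow q (N ∸ m) * pow q (suc m ℕ.+ e)        ≈⟨ *-congˡ (pow-+ q (suc m) e) ⟩
    pow q (N ∸ m) * (pow q (suc m) * pow q e)  ≈⟨ x∙yz≈yx∙z _ _ _ ⟩
    pow q (suc m) * pow q (N ∸ m) * pow q e    ≈⟨ *-congʳ (pow-+-∸ q (s≤s m≤N)) ⟩
    pow q (suc N) * pow q e                    ∎

  Recurrence : (ℕ → Carrier → Carrier) → Set (c Level.⊔ ℓ)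
  Recurrence F = ∀ N a → F (suc N) a ≈ (1# - a * pow q (suc N)) * F N a + a * pow q (suc N) * (F N (a * q) + 1#)

  recurrence-unique : ∀ {F G : ℕ → Carrier → Carrier} → (∀ a → F 0 a ≈ G 0 a) →
                      Recurrence F → Recurrence G → ∀ N a → F N a ≈ G N a
  recurrence-unique F₀≈G₀ recF recG zero    a = F₀≈G₀ a
  recurrence-unique F₀≈G₀ recF recG (suc N) a = begin
    _ ≈⟨ recF N a ⟩
    _ ≈⟨ +-cong (*-congˡ (recurrence-unique F₀≈G₀ recF recG N a))
                (*-congˡ (+-congʳ (recurrence-unique F₀≈G₀ recF recG N (a * q)))) ⟩
    _ ≈⟨ recG N a ⟨
    _ ∎

  τ : (ℕ → Carrier) → Carrier → ℕ → ℕ → Carrier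
  τ w a N n = w n * pow a n * pow q (n ℕ.* n) * poch (a * pow q (suc n)) q (N ∸ n)

  Στ : (ℕ → Carrier) → ℕ → Carrier → Carrier
  Στ w N a = sum0 N (λ n → gaussian N n * τ w a N n)

  τ-suc : ∀ w a {N n} → n ≤ N → τ w a (suc N) n ≈ (1# - a * pow q (suc N)) * τ w a N n
  τ-suc w a {N} {n} n≤N = begin
    h * poch x q (suc N ∸ n)
      ≡⟨ ≡.cong (λ k → h * poch x q k) (ℕₚ.+-∸-assoc 1 n≤N) ⟩
    h * (poch x q (N ∸ n) * (1# - x * pow q (N ∸ n)))
      ≈⟨ *-congˡ (*-congˡ (+-congˡ (-‿cong (trans (*-assoc a _ _) (*-congˡ (pow-+-∸ q (s≤s n≤N))))))) ⟩
    h * (poch x q (N ∸ n) * (1# - a * pow q (suc N)))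
      ≈⟨ x∙yz≈z∙xy _ _ _ ⟩
    (1# - a * pow q (suc N)) * (h * poch x q (N ∸ n)) ∎
    where
    x = a * pow q (suc n)
    h = w n * pow a n * pow q (n ℕ.* n)

  τ-shift : ∀ w a {N m} → m ≤ N →
            pow q (N ∸ m) * gaussian N m * τ w a (suc N) (suc m)
              ≈ a * pow q (suc N) * (gaussian N m * τ (λ n → w (suc n)) (a * q) N m)
  τ-shift w a {N} {m} m≤N = begin
    pow q (N ∸ m) * G * (W * (a * pow a m) * pow q (suc m ℕ.* suc m) * poch (a * pow q (2 ℕ.+ m)) q (N ∸ m))
      ≈⟨ *-congˡ (*-cong (*-congˡ (reflexive (≡.cong (λ e → pow q (suc m ℕ.+ e)) (ℕₚ.*-suc m m))))
                         (poch-cong q (N ∸ m) (sym (*-assoc a q _)))) ⟩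
    pow q (N ∸ m) * G * (W * (a * pow a m) * pow q (suc m ℕ.+ (m ℕ.+ m ℕ.* m)) * P)
      ≈⟨ solve 7 (λ Q G W A Am E P → Q :* G :* (W :* (A :* Am) :* E :* P)
                                     := A :* (Q :* E) :* (G :* (W :* Am :* P)))
           refl _ _ _ _ _ _ _ ⟩
    a * (pow q (N ∸ m) * pow q (suc m ℕ.+ (m ℕ.+ m ℕ.* m))) * (G * (W * pow a m * P))
      ≈⟨ *-congʳ (*-congˡ (trans (pow-shift (m ℕ.+ m ℕ.* m) m≤N) (*-congˡ (pow-+ q m (m ℕ.* m))))) ⟩
    a * (pow q (suc N) * (pow q m * pow q (m ℕ.* m))) * (G * (W * pow a m * P))
      ≈⟨ solve 8 (λ A Q Qm Qmm G W Am P → A :* (Q :* (Qm :* Qmm)) :* (G :* (W :* Am :* P))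
                                        := A :* Q :* (G :* (W :* (Am :* Qm) :* Qmm :* P)))
           refl _ _ _ _ _ _ _ _ ⟩
    a * pow q (suc N) * (G * (W * (pow a m * pow q m) * pow q (m ℕ.* m) * P))
      ≈⟨ *-congˡ (*-congˡ (*-congʳ (*-congʳ (*-congˡ (pow-* a q m))))) ⟨
    a * pow q (suc N) * (G * (W * pow (a * q) m * pow q (m ℕ.* m) * P)) ∎
    where
    G = gaussian N m
    W = w (suc m)
    P = poch (a * q * pow q (suc m)) q (N ∸ m)

  Στ-rec : ∀ w N a → Στ w (suc N) a ≈ (1# - a * pow q (suc N)) * Στ w N a
                                      + a * pow q (suc N) * Στ (λ n → w (suc n)) N (a * q)
  Στ-rec w N a = begin
    Στ w (suc N) a
      ≈⟨ pascal-sum0 N (τ w a (suc N)) ⟩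
    sum0 N (λ n → gaussian N n * τ w a (suc N) n)
      + sum0 N (λ m → pow q (N ∸ m) * gaussian N m * τ w a (suc N) (suc m))
      ≈⟨ +-cong (sum0-cong N (λ n n≤N → trans (*-congˡ (τ-suc w a n≤N)) (x∙yz≈y∙xz _ _ _)))
                (sum0-cong N (λ m m≤N → τ-shift w a m≤N)) ⟩
    sum0 N (λ n → (1# - X) * (gaussian N n * τ w a N n))
      + sum0 N (λ m → X * (gaussian N m * τ (λ n → w (suc n)) (a * q) N m))
      ≈⟨ +-cong (*-distribˡ-sum0 N (1# - X) _) (*-distribˡ-sum0 N X _) ⟨
    (1# - X) * Στ w N a + X * Στ (λ n → w (suc n)) N (a * q) ∎
    where X = a * pow q (suc N)

  Στ-distrib-+ : ∀ v w N a → Στ (λ n → v n + w n) N a ≈ Στ v N a + Στ w N a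
  Στ-distrib-+ v w N a = trans (sum0-cong N (λ n _ → term n)) (sum0-distrib-+ N _ _)
    where
    term : ∀ n → gaussian N n * τ (λ n → v n + w n) a N n
                   ≈ gaussian N n * τ v a N n + gaussian N n * τ w a N n
    term n = solve 6 (λ G v w A Q P → G :* ((v :+ w) :* A :* Q :* P)
                                      := G :* (v :* A :* Q :* P) :+ G :* (w :* A :* Q :* P))
               refl _ _ _ _ _ _

  Στ-one : ∀ N a → Στ (λ _ → 1#) N a ≈ 1#
  Στ-one zero    a = solve 0 (:1 :* (:1 :* :1 :* :1 :* :1) :+ :0 := :1) refl
  Στ-one (suc N) a = begin
    Στ (λ _ → 1#) (suc N) a
      ≈⟨ Στ-rec (λ _ → 1#) N a ⟩
    (1# - X) * Στ (λ _ → 1#) N a + X * Στ (λ _ → 1#) N (a * q)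
      ≈⟨ +-cong (*-congˡ (Στ-one N a)) (*-congˡ (Στ-one N (a * q))) ⟩
    (1# - X) * 1# + X * 1#
      ≈⟨ solve 1 (λ X → (:1 :- X) :* :1 :+ X :* :1 := :1) refl X ⟩
    1# ∎
    where X = a * pow q (suc N)

  Στ-fromℕ-recurrence : Recurrence (Στ fromℕ)
  Στ-fromℕ-recurrence N a = trans (Στ-rec fromℕ N a) (+-congˡ (*-congˡ (begin
    Στ (λ n → 1# + fromℕ n) N (a * q)           ≈⟨ Στ-distrib-+ (λ _ → 1#) fromℕ N (a * q) ⟩
    Στ (λ _ → 1#) N (a * q) + Στ fromℕ N (a * q) ≈⟨ +-congʳ (Στ-one N (a * q)) ⟩
    1# + Στ fromℕ N (a * q)                      ≈⟨ +-comm _ _ ⟩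
    Στ fromℕ N (a * q) + 1#                      ∎)))

  ρ : Carrier → ℕ → Carrier
  ρ a zero    = 0#
  ρ a (suc m) = q! m * pow (- 1#) m * pow a (suc m) * pow q (triangle (suc m))

  σ : Carrier → ℕ → Carrier
  σ a n = q! n * pow (- 1#) n * pow a n * pow q (triangle n)

  Σρ Σσ : ℕ → Carrier → Carrier
  Σρ N a = sum0 N (λ n → gaussian N n * ρ a n)
  Σσ N a = sum0 N (λ n → gaussian N n * σ a n)

  ρ-shift : ∀ a {N m} → m ≤ N →
            pow q (N ∸ m) * gaussian N m * ρ a (suc m) ≈ a * pow q (suc N) * (gaussian N m * σ a m)
  ρ-shift a {N} {m} m≤N = begin
    pow q (N ∸ m) * G * (q! m * S * (a * pow a m) * pow q (suc m ℕ.+ triangle m))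
      ≈⟨ solve 7 (λ Q G P S A Am E → Q :* G :* (P :* S :* (A :* Am) :* E)
                                     := A :* (G :* (P :* S :* Am)) :* (Q :* E))
           refl _ _ _ _ _ _ _ ⟩
    a * (G * (q! m * S * pow a m)) * (pow q (N ∸ m) * pow q (suc m ℕ.+ triangle m))
      ≈⟨ *-congˡ (pow-shift (triangle m) m≤N) ⟩
    a * (G * (q! m * S * pow a m)) * (pow q (suc N) * pow q (triangle m))
      ≈⟨ solve 7 (λ A G P S Am Q T → A :* (G :* (P :* S :* Am)) :* (Q :* T)
                                     := A :* Q :* (G :* (P :* S :* Am :* T)))
           refl _ _ _ _ _ _ _ ⟩
    a * pow q (suc N) * (G * σ a m) ∎
    where
    G = gaussian N m
    S = pow (- 1#) m

  σ-split : ∀ a m → σ a (suc m) ≈ ρ (a * q) (suc m) - ρ a (suc m)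
  σ-split a m = begin
    q! m * (1# - q * pow q m) * (- 1# * pow (- 1#) m) * (a * pow a m) * E
      ≈⟨ solve 7 (λ P Q Qm S A Am E → P :* (:1 :- Q :* Qm) :* (:- :1 :* S) :* (A :* Am) :* E
                                     := P :* S :* ((A :* Am) :* (Q :* Qm)) :* E :- P :* S :* (A :* Am) :* E)
           refl _ _ _ _ _ _ _ ⟩
    q! m * pow (- 1#) m * (pow a (suc m) * pow q (suc m)) * E - ρ a (suc m)
      ≈⟨ +-congʳ (*-congʳ (*-congˡ (pow-* a q (suc m)))) ⟨
    ρ (a * q) (suc m) - ρ a (suc m) ∎
    where E = pow q (triangle (suc m))

  Σρ≈sum1 : ∀ N a → Σρ N a ≈ sum1 N (λ n → gaussian N n * ρ a n)
  Σρ≈sum1 N a = sum0≈sum1 N (zeroʳ (gaussian N 0))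

  Σσ≈1+[Σρ[aq]-Σρ] : ∀ N a → Σσ N a ≈ 1# + (Σρ N (a * q) - Σρ N a)
  Σσ≈1+[Σρ[aq]-Σρ] N a = begin
    1# * (1# * 1# * 1# * 1#) + sum1 N (λ n → gaussian N n * σ a n)
      ≈⟨ +-cong (solve 0 (:1 :* (:1 :* :1 :* :1 :* :1) := :1) refl)
                (sum1-cong N (λ m _ → trans (*-congˡ (σ-split a m)) (x[y-z]≈xy-xz _ _ _))) ⟩
    1# + sum1 N (λ n → gaussian N n * ρ (a * q) n - gaussian N n * ρ a n)
      ≈⟨ +-congˡ (sum1-distrib-− N _ _) ⟩
    1# + (sum1 N (λ n → gaussian N n * ρ (a * q) n) - sum1 N (λ n → gaussian N n * ρ a n))
      ≈⟨ +-congˡ (+-cong (Σρ≈sum1 N (a * q)) (-‿cong (Σρ≈sum1 N a))) ⟨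
    1# + (Σρ N (a * q) - Σρ N a) ∎

  Σρ-recurrence : Recurrence Σρ
  Σρ-recurrence N a = begin
    Σρ (suc N) a                                 ≈⟨ pascal-sum0 N (ρ a) ⟩
    Σρ N a + sum0 N (λ m → pow q (N ∸ m) * gaussian N m * ρ a (suc m))
      ≈⟨ +-congˡ (trans (sum0-cong N (λ m m≤N → ρ-shift a m≤N)) (sym (*-distribˡ-sum0 N _ _))) ⟩
    Σρ N a + X * Σσ N a                          ≈⟨ +-congˡ (*-congˡ (Σσ≈1+[Σρ[aq]-Σρ] N a)) ⟩
    Σρ N a + X * (1# + (Σρ N (a * q) - Σρ N a))
      ≈⟨ solve 3 (λ X r r′ → r :+ X :* (:1 :+ (r′ :- r)) := (:1 :- X) :* r :+ X :* (r′ :+ :1))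
           refl _ _ _ ⟩
    (1# - X) * Σρ N a + X * (Σρ N (a * q) + 1#) ∎
    where X = a * pow q (suc N)

  Στ≈Σρ : ∀ N a → Στ fromℕ N a ≈ Σρ N a
  Στ≈Σρ = recurrence-unique base Στ-fromℕ-recurrence Σρ-recurrence
    where
    base : ∀ a → Στ fromℕ 0 a ≈ Σρ 0 a
    base a = solve 0 (:1 :* (:0 :* :1 :* :1 :* :1) :+ :0 := :1 :* :0 :+ :0) refl

  Στ≈sum1 : ∀ N a → Στ fromℕ N a ≈ sum1 N (λ n → gaussian N n * τ fromℕ a N n)
  Στ≈sum1 N a = sum0≈sum1 N (solve 1 (λ P → :1 :* (:0 :* :1 :* :1 :* P) := :0) refl _)

  lhs-term : ∀ a (iq iaq : ℕ → Carrier) {N} →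
             (∀ k → k ≤ N → q! k * iq k ≈ 1#) →
             (∀ k → k ≤ N → poch (a * q) q k * iaq k ≈ 1#) →
             ∀ {n} → n ≤ N →
             poch (a * q) q N * (qbinom q iq N n * (fromℕ n * pow a n * pow q (n ℕ.* n)) * iaq n)
               ≈ gaussian N n * τ fromℕ a N n
  lhs-term a iq iaq {N} iq-inverse iaq-inverse {n} n≤N = begin
    poch (a * q) q N * (qbinom q iq N n * H * iaq n)
      ≡⟨ ≡.cong (λ k → poch (a * q) q k * (qbinom q iq N n * H * iaq n)) (ℕₚ.m+[n∸m]≡n n≤N) ⟨
    poch (a * q) q (n ℕ.+ (N ∸ n)) * (qbinom q iq N n * H * iaq n)
      ≈⟨ *-cong (poch-+ (a * q) q n (N ∸ n)) (*-congʳ (*-congʳ (qbinom≈gaussian iq iq-inverse n≤N))) ⟩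
    poch (a * q) q n * poch (a * q * pow q n) q (N ∸ n) * (gaussian N n * H * iaq n)
      ≈⟨ solve 5 (λ A P G H I → A :* P :* (G :* H :* I) := (A :* I) :* (G :* (H :* P))) refl _ _ _ _ _ ⟩
    (poch (a * q) q n * iaq n) * (gaussian N n * (H * poch (a * q * pow q n) q (N ∸ n)))
      ≈⟨ *-cong (iaq-inverse n n≤N) (*-congˡ (*-congˡ (poch-cong q (N ∸ n) (*-assoc a q _)))) ⟩
    1# * (gaussian N n * τ fromℕ a N n)
      ≈⟨ *-identityˡ _ ⟩
    gaussian N n * τ fromℕ a N n ∎
    where H = fromℕ n * pow a n * pow q (n ℕ.* n)

  rhs-term : ∀ a (iq iz : ℕ → Carrier) {N} →
             (∀ k → k ≤ N → q! k * iq k ≈ 1#) →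
             (∀ k → 1 ≤ k → k ≤ N → (1# - pow q k) * iz k ≈ 1#) →
             ∀ {m} → m < N →
             qbinom q iq N (suc m) * q! (suc m) * pow (- 1#) m * pow a (suc m)
               * pow q ((suc m ℕ.* suc (suc m)) / 2) * iz (suc m)
               ≈ gaussian N (suc m) * ρ a (suc m)
  rhs-term a iq iz {N} iq-inverse iz-inverse {m} m<N = begin
    B * (q! m * (1# - pow q (suc m))) * S * A * pow q ((suc m ℕ.* suc (suc m)) / 2) * iz (suc m)
      ≡⟨ ≡.cong (λ e → B * (q! m * (1# - pow q (suc m))) * S * A * pow q e * iz (suc m))
                (n*[1+n]/2≡triangle (suc m)) ⟩
    B * (q! m * (1# - pow q (suc m))) * S * A * E * iz (suc m)
      ≈⟨ solve 7 (λ B P Z S A E I → B :* (P :* Z) :* S :* A :* E :* I := (Z :* I) :* (B :* (P :* S :* A :* E)))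
           refl _ _ _ _ _ _ _ ⟩
    ((1# - pow q (suc m)) * iz (suc m)) * (B * ρ a (suc m))
      ≈⟨ *-cong (iz-inverse (suc m) (s≤s z≤n) m<N) (*-congʳ (qbinom≈gaussian iq iq-inverse m<N)) ⟩
    1# * (gaussian N (suc m) * ρ a (suc m))
      ≈⟨ *-identityˡ _ ⟩
    gaussian N (suc m) * ρ a (suc m) ∎
    where
    B = qbinom q iq N (suc m)
    S = pow (- 1#) m
    A = pow a (suc m)
    E = pow q (triangle (suc m))

theorem3p2 : ∀ {c ℓ : Level} (R : CommutativeRing c ℓ) →
    let open CommutativeRing R
        open QDefs R
    in
    (a q : Carrier) (N : ℕ) →
    (iq : ℕ → Carrier) → (∀ k → k ≤ N → poch q q k * iq k ≈ 1#) →
    (iaq : ℕ → Carrier) → (∀ k → k ≤ N → poch (a * q) q k * iaq k ≈ 1#) →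
    (iz : ℕ → Carrier) → (∀ k → 1 ≤ k → k ≤ N → (1# - pow q k) * iz k ≈ 1#) →
    poch (a * q) q N
      * sum1 N (λ n → qbinom q iq N n * (fromℕ n * pow a n * pow q (n *ℕ n)) * iaq n)
    ≈ sum1 N (λ n → qbinom q iq N n * poch q q n * pow (- 1#) (n ∸ 1)
                     * pow a n * pow q ((n *ℕ suc n) / 2) * iz n)
theorem3p2 R a q N iq iq-inverse iaq iaq-inverse iz iz-inverse = begin
  poch (a * q) q N * sum1 N _
    ≈⟨ *-distribˡ-sum1 N _ _ ⟩
  sum1 N _
    ≈⟨ sum1-cong N (λ m m<N → lhs-term a iq iaq iq-inverse iaq-inverse m<N) ⟩
  sum1 N (λ n → gaussian N n * τ fromℕ a N n)
    ≈⟨ Στ≈sum1 N a ⟨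
  Στ fromℕ N a
    ≈⟨ Στ≈Σρ N a ⟩
  Σρ N a
    ≈⟨ Σρ≈sum1 N a ⟩
  sum1 N (λ n → gaussian N n * ρ a n)
    ≈⟨ sum1-cong N (λ m m<N → rhs-term a iq iz iq-inverse iz-inverse m<N) ⟨
  sum1 N _ ∎
  where
  open CommutativeRing R
  open QDefs R
  open Sums R
  open GaussianBinomials R q
  open BothSides R q
  open import Relation.Binary.Reasoning.Setoid setoid
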